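{- Assume $K_n$ has vertex set $\{v_1, v_2, \ldots, v_n\}$ and $f: V(K_n) \to \mathbb{Z}$ is a mapping with $f(v_1) \le f(v_2) \le \ldots \le f(v_n)$. Then $$m_c(K_n,f)=m_p(K_n,f)=\psi( \vec{x}(f) ).$$ In other words, for an integer $m \ge 0$, for $G=K_n \vee \overline{K_m}$, the following are equivalent: 1. $G$ is $f^{(m)}$-choosable. 2. $G$ is $f^{(m)}$-paintable. 3. $m < \psi(\vec{x}(f))$.
   Context: For graphs $G,H$, the join $G \vee H$ is obtained from the disjoint union of $G$ and $H$ by adding all edges between $V(G)$ and $V(H)$; $\overline{K_m}$ is the edgeless graph on $m$ vertices. For a graph $G$ and $f:V(G)\to\mathbb{N}$, $f^{(m)}$ is the extension of $f$ to $G \vee \overline{K_m}$ with $f^{(m)}(v)=|V(G)|$ for each vertex $v$ of $\overline{K_m}$; $m_c(G,f)$ (resp. $m_p(G,f)$) is the minimum $m$ such that $G \vee \overline{K_m}$ is not $f^{(m)}$-choosable (resp. not $f^{(m)}$-paintable). $G$ is $f$-choosable if it has a proper colouring from any lists $L(v)$ with $|L(v)|=f(v)$; $f$-paintable means Painter wins the online list colouring (painting) game with $f(v)$ tokens on each vertex $v$. For $\vec{x}=(x_1,\ldots,x_n)$ of nonnegative integers, an $\vec{x}$-dominated lattice path ending at $(a,b)$ is a lattice path from $(0,0)$ to $(a,b)$ using unit steps right $(1,0)$ and up $(0,1)$ such that every vertex $(i,j)$ on it satisfies $i \le x_{j+1}$; $\psi(\vec{x})$ is the number of $\vec{x}$-dominated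 lattice paths ending at $(x_n,n)$. For $f$ with $f(v_1)\le\cdots\le f(v_n)$, $\vec{x}(f)=(x_1,\ldots,x_n)$ with $x_i=f(v_i)-i$. -}

module Defs where

open import Data.Nat as ℕ using (ℕ; zero; suc; _+_; _∸_; _<_; _<?_; _≡ᵇ_)
open import Data.Integer as ℤ using (ℤ; +_; -[1+_]; _-_; _≤?_)
open import Data.Fin using (Fin; toℕ; fromℕ; fromℕ<; splitAt)
open import Data.Fin.Subset using (Subset; _∈_; _⊆_; _─_; Nonempty)
open import Data.Vec using (lookup)
open import Data.Bool using (Bool; true; false; _∧_; not; if_then_else_)
open import Data.List using (List; []; _∷_; length; filterᵇ; concatMap)
open import Data.List.Membership.Propositional using () renaming (_∈_ to _∈ₗ_)
open import Data.List.Relation.Unary.Unique.Propositional using (Unique)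
open import Data.Product using (Σ; ∃; _×_; _,_)
open import Data.Sum using (_⊎_; inj₁; inj₂)
open import Data.Unit using (⊤)
open import Data.Empty using (⊥)
open import Relation.Nullary using (¬_; does)
open import Relation.Binary.PropositionalEquality using (_≡_; _≢_)

Choosable : (N : ℕ) → (Fin N → Fin N → Set) → (Fin N → ℕ) → Set
Choosable N E f =
  (L : Fin N → List ℕ) →
  (∀ v → Unique (L v)) →
  (∀ v → length (L v) ≡ f v) →
  Σ (Fin N → ℕ) λ c → (∀ v → c v ∈ₗ L v) × (∀ u v → E u v → c u ≢ c v)

Independent : {N : ℕ} → (Fin N → Fin N → Set) → Subset N → Set
Independent E I = ∀ u v → u ∈ I → v ∈ I → ¬ E u v

updateTokens : {N : ℕ} → Subset N → Subset N → (Fin N → ℕ) → Fin N → ℕ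
updateTokens M I f v = if lookup M v ∧ not (lookup I v) then f v ∸ 1 else f v

-- Painting game (Schauz): the induced subgraph on the remaining vertex
-- set R is f-paintable iff every remaining vertex has a token and for
-- every nonempty M ⊆ R there is an independent I ⊆ M such that the
-- subgraph on R ─ I is f'-paintable (f' = updateTokens M I f).
-- (If R is empty the conditions hold vacuously.)  Inductive, i.e.
-- Painter has a winning strategy in the (finite) game.
data PaintableOn {N : ℕ} (E : Fin N → Fin N → Set) : Subset N → (Fin N → ℕ) → Set where
  step : ∀ {R f} →
    (∀ v → v ∈ R → 1 ℕ.≤ f v) →
    (∀ M → M ⊆ R → Nonempty M →
      Σ (Subset N) λ I → I ⊆ M × Independent E I ×
        PaintableOn E (R ─ I) (updateTokens M I f)) →
    PaintableOn E R f

Paintable : (N : ℕ) → (Fin N → Fin N → Set) → (Fin N → ℕ) → Set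
Paintable N E f = PaintableOn E (Data.Fin.Subset.⊤) f

JoinAdj : (n m : ℕ) → Fin (n + m) → Fin (n + m) → Set
JoinAdj n m u v with splitAt n u | splitAt n v
... | inj₁ a | inj₁ b = a ≢ b
... | inj₁ _ | inj₂ _ = ⊤
... | inj₂ _ | inj₁ _ = ⊤
... | inj₂ _ | inj₂ _ = ⊥

ext : (n m : ℕ) → (Fin n → ℕ) → Fin (n + m) → ℕ
ext n m f v with splitAt n v
... | inj₁ a = f a
... | inj₂ _ = n

data Step : Set where
  R U : Step

allPaths : ℕ → List (List Step)
allPaths zero = [] ∷ []
allPaths (suc L) = concatMap (λ p → (R ∷ p) ∷ (U ∷ p) ∷ []) (allPaths L)

-- domination condition at vertex (i , j): i ≤ x_{j+1}, where
-- x = (x_1,…,x_N) is 0-indexed as x : Fin N → ℤ.  For j ≥ N there is no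
-- x_{j+1}; no condition is imposed there (only the endpoint (x_N , N)
-- can have j = N, and i = x_N there).
okAt : {N : ℕ} → (Fin N → ℤ) → ℕ → ℕ → Bool
okAt {N} x i j with j <? N
... | Relation.Nullary.yes p = does (+ i ≤? x (fromℕ< p))
... | Relation.Nullary.no _ = true

dominated : {N : ℕ} → (Fin N → ℤ) → ℕ → ℕ → List Step → Bool
dominated x i j [] = okAt x i j
dominated x i j (R ∷ p) = okAt x i j ∧ dominated x (suc i) j p
dominated x i j (U ∷ p) = okAt x i j ∧ dominated x i (suc j) p

endsAt : ℕ → ℕ → List Step → ℕ → ℕ → Bool
endsAt i j [] a b = (i ≡ᵇ a) ∧ (j ≡ᵇ b)
endsAt i j (R ∷ p) a b = endsAt (suc i) j p a b
endsAt i j (U ∷ p) a b = endsAt i (suc j) p a b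

-- number of x-dominated lattice paths from (0,0) ending at (a , b)
-- (every such path has exactly a + b steps)
countDominated : {N : ℕ} → (Fin N → ℤ) → ℕ → ℕ → ℕ
countDominated x a b =
  length (filterᵇ (λ p → dominated x 0 0 p ∧ endsAt 0 0 p a b) (allPaths (a + b)))

-- ψ(x) for x = (x_1,…,x_n), n ≥ 1: paths ending at (x_n , n).
-- If x_n < 0 there is no such lattice path, so ψ = 0.
ψ : {n : ℕ} → (Fin (suc n) → ℤ) → ℕ
ψ {n} x with x (fromℕ n)
... | + a = countDominated x a (suc n)
... | -[1+ _ ] = 0

-- x(f)_i = f(v_i) - i  (1-indexed i; here vertex v_{k+1} is k : Fin n)
xvec : {n : ℕ} → (Fin n → ℕ) → Fin n → ℤ
xvec f k = + f k - + suc (toℕ k)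

-- Reading a lattice path off the times of its up-steps, the dominated paths counted
-- by ψ(x(f)) are the increasing sequences t₁ < ⋯ < tₙ with tᵢ < f(vᵢ).
--
-- A winning Painter yields list colourings (Schauz): for a colour c, Lister marks the
-- vertices whose lists contain c, and Painter's answer is coloured c.
--
-- If m ≥ ψ, give vᵢ the colours 0, …, f(vᵢ) − 1 and the independent vertices the
-- sets {t₁, …, tₙ} of all these sequences.  In a proper colouring the clique colours
-- are distinct and v₁, …, vᵢ use colours below f(vᵢ), so sorted they form one of the
-- sequences, and the independent vertex carrying it has no colour left.
--
-- If m < ψ, Painter keeps fewer threatened independent vertices (those with at most
-- as many tokens as clique vertices left) than increasing sequences below the tokens
-- of the remaining clique.  If v is the first marked clique vertex, decrementing the
-- marked tokens loses at most as many sequences as the decremented tokens admit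
-- without v, so either colouring v (the marked threatened vertices stay threatened)
-- or colouring the marked independent vertices (the unmarked ones do) preserves the
-- invariant.

module Submission where

open import Defs
open import Data.Nat using (ℕ; zero; suc; _+_; _∸_; _≤_; _<_; z≤n; s≤s; z<s; s≤s⁻¹; _≟_; _≤?_; _<?_)
open import Data.Nat.Properties
open import Data.Nat.ListAction using (sum)
open import Algebra.Properties.CommutativeSemigroup +-commutativeSemigroup using (interchange)
open import Data.Integer as ℤ using (ℤ; -[1+_])
import Data.Integer.Properties as ℤₚ
open import Data.Fin using (Fin; toℕ; fromℕ; fromℕ<; inject≤; _↑ˡ_; _↑ʳ_; splitAt; join)
open import Data.Fin.Base using () renaming (_≤_ to _≤ᶠ_)
import Data.Fin.Properties as Finₚ
open import Data.Fin.Subset using (Subset; ⊤; inside; outside; _∈_; _∉_; _⊆_; _─_; Nonempty; ⁅_⁆)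
open import Data.Fin.Subset.Properties using (_∈?_; nonempty?; ∈⊤; x∈p∧x∉q⇒x∈p─q; p─q⊆p; x∈⁅x⁆; x∈⁅y⁆⇒x≡y)
open import Data.Vec using (_∷_; here; there; lookup; tabulate)
open import Data.Vec.Properties using (lookup∘tabulate; []=⇒lookup; lookup⇒[]=)
open import Data.Bool using (Bool; true; false; _∧_; not; if_then_else_; T; T?)
open import Data.Bool.Properties using (T-∧; T-≡)
open import Data.List using (List; []; _∷_; _++_; map; allFin; length; filter; filterᵇ; upTo; concatMap; drop)
  renaming (tabulate to tabulateₗ; lookup to lookupₗ)
open import Data.List.Properties
  using (length-removeAt′; map-cong; map-cong-local; length-filter; map-tabulate; tabulate-cong; drop-all
        ; filter-all; filter-accept; filter-reject; filter-none; length-tabulate; length-upTo)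
open import Data.List.Membership.Propositional using () renaming (_∈_ to _∈ₗ_; _∉_ to _∉ₗ_)
open import Data.List.Membership.DecPropositional _≟_ using () renaming (_∈?_ to _∈ₗ?_)
open import Data.List.Membership.Propositional.Properties
  using (∈-filter⁺; ∈-filter⁻; ∈-concatMap⁺
        ; ∈-tabulate⁺; ∈-tabulate⁻; ∈-upTo⁺; ∈-upTo⁻; ∈-lookup; ∈-allFin; ∈-map⁺)
open import Data.List.Relation.Binary.Subset.Propositional using () renaming (_⊆_ to _⊆ₗ_)
open import Data.List.Relation.Unary.All as All using (All; []; _∷_)
open import Data.List.Relation.Unary.All.Properties as Allₚ using (¬Any⇒All¬; All¬⇒¬Any)
open import Data.List.Relation.Unary.AllPairs using ([]; _∷_)
open import Data.List.Relation.Unary.Any as Any using (here; there; index)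
open import Data.List.Relation.Unary.Any.Properties using (lookup-index)
open import Data.List.Relation.Unary.Unique.Propositional using (Unique)
open import Data.List.Relation.Unary.Unique.Propositional.Properties using (filter⁺; tabulate⁺; upTo⁺; allFin⁺)
open import Data.Product using (Σ; ∃; _×_; _,_; proj₁; proj₂; map₂)
open import Data.Sum using (_⊎_; inj₁; inj₂)
open import Data.Unit using (tt)
open import Function using (_∘_; id)
open import Function.Bundles using (_⇔_; mk⇔; Equivalence)
open import Relation.Nullary using (¬_; Dec; yes; no; does; ¬?; contradiction; _×-dec_)
open import Relation.Nullary.Decidable using (dec-true; dec-false)
open import Relation.Unary using (Pred; Decidable)
open import Level using (0ℓ)
open import Relation.Binary.PropositionalEquality

∈-─⁺ : ∀ {A : Set} {x y : A} {ys} (x∈ys : x ∈ₗ ys) → y ∈ₗ ys → y ≢ x → y ∈ₗ (ys Any.─ x∈ys)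
∈-─⁺ (here refl) (here refl) y≢x = contradiction refl y≢x
∈-─⁺ (here refl) (there y∈ys) _ = y∈ys
∈-─⁺ (there _) (here refl) _ = here refl
∈-─⁺ (there x∈ys) (there y∈ys) y≢x = there (∈-─⁺ x∈ys y∈ys y≢x)

Unique-⊆⇒length-≤ : ∀ {A : Set} {xs ys : List A} → Unique xs → xs ⊆ₗ ys → length xs ≤ length ys
Unique-⊆⇒length-≤ {xs = []} _ _ = z≤n
Unique-⊆⇒length-≤ {xs = x ∷ xs} {ys} (x∉xs ∷ unique) xs⊆ys = begin
  suc (length xs)            ≤⟨ s≤s (Unique-⊆⇒length-≤ unique xs⊆ys─x) ⟩
  suc (length (ys Any.─ x∈ys)) ≡⟨ length-removeAt′ ys (index x∈ys) ⟨
  length ys                  ∎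
  where
  open ≤-Reasoning
  x∈ys = xs⊆ys (here refl)
  xs⊆ys─x : xs ⊆ₗ (ys Any.─ x∈ys)
  xs⊆ys─x y∈xs = ∈-─⁺ x∈ys (xs⊆ys (there y∈xs)) (All.lookup x∉xs y∈xs ∘ sym)

module _ (c : ℕ) where

  ≢c? : Decidable (_≢ c)
  ≢c? y = ¬? (y ≟ c)

  remove : List ℕ → List ℕ
  remove = filter ≢c?

  ∈-remove⁻ : ∀ {x} xs → x ∈ₗ remove xs → x ∈ₗ xs × x ≢ c
  ∈-remove⁻ xs = ∈-filter⁻ ≢c? {xs = xs}

  ∈-remove⁺ : ∀ {x xs} → x ∈ₗ xs → x ≢ c → x ∈ₗ remove xs
  ∈-remove⁺ = ∈-filter⁺ ≢c?

  remove-∉ : ∀ {xs} → c ∉ₗ xs → remove xs ≡ xs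
  remove-∉ c∉xs = filter-all ≢c? (All.map (_∘ sym) (¬Any⇒All¬ _ c∉xs))

  Unique-remove : ∀ {xs} → Unique xs → Unique (remove xs)
  Unique-remove = filter⁺ ≢c?

  length-remove : ∀ {xs} → Unique xs → length xs ∸ 1 ≤ length (remove xs)
  length-remove {xs} unique = m≤n+o⇒m∸n≤o (length xs) 1 (Unique-⊆⇒length-≤ unique xs⊆c∷rest)
    where
    xs⊆c∷rest : xs ⊆ₗ c ∷ remove xs
    xs⊆c∷rest {x} x∈xs with x ≟ c
    ... | yes refl = here refl
    ... | no x≢c = there (∈-remove⁺ x∈xs x≢c)

nonempty-member : ∀ {A : Set} {xs : List A} → 1 ≤ length xs → ∃ (_∈ₗ xs)
nonempty-member {xs = x ∷ _} _ = x , here refl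

length-filterᵇ-partition : ∀ {A : Set} (p : A → Bool) xs →
  length (filterᵇ p xs) + length (filterᵇ (not ∘ p) xs) ≡ length xs
length-filterᵇ-partition p [] = refl
length-filterᵇ-partition p (x ∷ xs) with p x
... | true = cong suc (length-filterᵇ-partition p xs)
... | false = trans (+-suc _ _) (cong suc (length-filterᵇ-partition p xs))

sum-map-mono : ∀ {A : Set} {f g : A → ℕ} xs → (∀ x → f x ≤ g x) → sum (map f xs) ≤ sum (map g xs)
sum-map-mono [] f≤g = z≤n
sum-map-mono (x ∷ xs) f≤g = +-mono-≤ (f≤g x) (sum-map-mono xs f≤g)

sum-map-mono-< : ∀ {A : Set} {f g : A → ℕ} {xs x} → x ∈ₗ xs → f x < g x → (∀ x → f x ≤ g x) →
  sum (map f xs) < sum (map g xs)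
sum-map-mono-< {xs = y ∷ ys} (here refl) fx<gx f≤g = +-mono-<-≤ fx<gx (sum-map-mono ys f≤g)
sum-map-mono-< {xs = y ∷ ys} (there x∈) fx<gx f≤g = +-mono-≤-< (f≤g y) (sum-map-mono-< x∈ fx<gx f≤g)

drop-tabulate : ∀ {A : Set} {N} (f : Fin N → A) j (j<N : j < N) →
  drop j (tabulateₗ f) ≡ f (fromℕ< j<N) ∷ drop (suc j) (tabulateₗ f)
drop-tabulate {N = suc N} f zero j<N = refl
drop-tabulate {N = suc N} f (suc j) j<N = drop-tabulate (f ∘ Fin.suc) j (s≤s⁻¹ j<N)

last-∈-drop-tabulate : ∀ {A : Set} {n} (f : Fin (suc n) → A) j → j ≤ n → f (fromℕ n) ∈ₗ drop j (tabulateₗ f)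
last-∈-drop-tabulate {n = n} f zero _ = ∈-tabulate⁺ {f = f} (fromℕ n)
last-∈-drop-tabulate {n = suc n} f (suc j) j<n = last-∈-drop-tabulate (f ∘ Fin.suc) j (s≤s⁻¹ j<n)

module _ {A : Set} where

  FirstSplit : (A → Bool) → List A → Set
  FirstSplit p xs = Σ (List A) λ pre → Σ A λ v → Σ (List A) λ post →
    xs ≡ pre ++ v ∷ post × All (λ u → p u ≡ false) pre × p v ≡ true

  firstSplit : ∀ (p : A → Bool) xs → FirstSplit p xs ⊎ All (λ u → p u ≡ false) xs
  firstSplit p [] = inj₂ []
  firstSplit p (x ∷ xs) with p x in px
  ... | true = inj₁ ([] , x , xs , refl , [] , px)
  ... | false with firstSplit p xs
  ...   | inj₂ none = inj₂ (px ∷ none)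
  ...   | inj₁ (pre , v , post , xs≡ , pre-false , pv) = inj₁ (x ∷ pre , v , post , cong (x ∷_) xs≡ , px ∷ pre-false , pv)

  Unique-delete : ∀ pre {v : A} {post} → Unique (pre ++ v ∷ post) → Unique (pre ++ post) × v ∉ₗ pre ++ post
  Unique-delete [] (v∉post ∷ unique) = unique , All¬⇒¬Any v∉post
  Unique-delete (x ∷ pre) (x∉rest ∷ unique) with unique′ , v∉ ← Unique-delete pre unique =
    Allₚ.++⁺ (Allₚ.++⁻ˡ pre x∉rest) (All.tail (Allₚ.++⁻ʳ pre x∉rest)) ∷ unique′ ,
    λ { (here refl) → All.head (Allₚ.++⁻ʳ pre x∉rest) refl ; (there v∈) → v∉ v∈ }

  ∈-insert : ∀ pre {v : A} {post x} → x ∈ₗ pre ++ post → x ∈ₗ pre ++ v ∷ post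
  ∈-insert [] x∈ = there x∈
  ∈-insert (y ∷ pre) (here refl) = here refl
  ∈-insert (y ∷ pre) (there x∈) = there (∈-insert pre x∈)

  ∈-delete : ∀ pre {v : A} {post x} → x ∈ₗ pre ++ v ∷ post → x ≢ v → x ∈ₗ pre ++ post
  ∈-delete [] (here refl) x≢v = contradiction refl x≢v
  ∈-delete [] (there x∈) _ = x∈
  ∈-delete (y ∷ pre) (here refl) _ = here refl
  ∈-delete (y ∷ pre) (there x∈) x≢v = there (∈-delete pre x∈ x≢v)

  length-delete : ∀ pre {v : A} {post} → length (pre ++ v ∷ post) ≡ suc (length (pre ++ post))
  length-delete [] = refl
  length-delete (y ∷ pre) = cong suc (length-delete pre)

x∈p─q⇒x∉q : ∀ {N} {x : Fin N} (p q : Subset N) → x ∈ p ─ q → x ∉ q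
x∈p─q⇒x∉q (inside ∷ p) (outside ∷ q) here ()
x∈p─q⇒x∉q (_ ∷ p) (_ ∷ q) (there x∈p─q) (there x∈q) = x∈p─q⇒x∉q p q x∈p─q x∈q

module _ {N : ℕ} where

  ∉⇒lookup : ∀ {x : Fin N} {p} → x ∉ p → lookup p x ≡ false
  ∉⇒lookup {x} {p} x∉p with lookup p x in eq
  ... | true = contradiction (lookup⇒[]= x p eq) x∉p
  ... | false = refl

  subsetOf : {P : Pred (Fin N) 0ℓ} → Decidable P → Subset N
  subsetOf P? = tabulate (λ v → does (P? v))

  module _ {P : Pred (Fin N) 0ℓ} (P? : Decidable P) where

    ∈-subsetOf⁺ : ∀ {v} → P v → v ∈ subsetOf P?
    ∈-subsetOf⁺ {v} pv = lookup⇒[]= v _ (trans (lookup∘tabulate _ v) (dec-true (P? v) pv))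

    ∈-subsetOf⁻ : ∀ {v} → v ∈ subsetOf P? → P v
    ∈-subsetOf⁻ {v} v∈ with P? v | trans (sym (lookup∘tabulate (λ u → does (P? u)) v)) ([]=⇒lookup v∈)
    ... | yes pv | _ = pv
    ... | no _ | ()

  updateTokens-∉ : ∀ M I (f : Fin N → ℕ) {v} → v ∉ I →
    updateTokens M I f v ≡ (if lookup M v then f v ∸ 1 else f v)
  updateTokens-∉ M I f {v} v∉I rewrite ∉⇒lookup v∉I with lookup M v
  ... | true = refl
  ... | false = refl

-- Paintability implies choosability

module _ {N : ℕ} (E : Fin N → Fin N → Set) where

  ColouringOn : Subset N → (Fin N → List ℕ) → Set
  ColouringOn S L = Σ (Fin N → ℕ) λ c →
    (∀ v → v ∈ S → c v ∈ₗ L v) × (∀ u v → u ∈ S → v ∈ S → E u v → c u ≢ c v)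

  paintableOn⇒colourableOn : ∀ {S f} → PaintableOn E S f →
    (L : Fin N → List ℕ) → (∀ v → Unique (L v)) → (∀ v → v ∈ S → f v ≤ length (L v)) →
    ColouringOn S L
  paintableOn⇒colourableOn {S} {f} (step tokens move) L unique long with nonempty? S
  ... | no S-empty =
    (λ _ → 0) , (λ v v∈S → contradiction (v , v∈S) S-empty) , (λ u _ u∈S → contradiction (u , u∈S) S-empty)
  ... | yes (v₀ , v₀∈S) =
    extend (paintableOn⇒colourableOn (proj₂ (proj₂ (proj₂ (move M M⊆S M-nonempty)))) L′ (Unique-remove col ∘ unique) long′)
    where
    some-colour : ∃ (_∈ₗ L v₀)
    some-colour = nonempty-member (≤-trans (tokens v₀ v₀∈S) (long v₀ v₀∈S))

    col : ℕ
    col = proj₁ some-colour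

    marked? : Decidable (λ v → v ∈ S × col ∈ₗ L v)
    marked? v = v ∈? S ×-dec col ∈ₗ? L v

    M : Subset N
    M = subsetOf marked?

    M⊆S : M ⊆ S
    M⊆S = proj₁ ∘ ∈-subsetOf⁻ marked?

    M-nonempty : Nonempty M
    M-nonempty = v₀ , ∈-subsetOf⁺ marked? (v₀∈S , proj₂ some-colour)

    answer : Σ (Subset N) λ I → I ⊆ M × Independent E I × PaintableOn E (S ─ I) (updateTokens M I f)
    answer = move M M⊆S M-nonempty

    I : Subset N
    I = proj₁ answer

    I⊆M : I ⊆ M
    I⊆M = proj₁ (proj₂ answer)

    I-independent : Independent E I
    I-independent = proj₁ (proj₂ (proj₂ answer))

    L′ : Fin N → List ℕ
    L′ v = remove col (L v)

    long′ : ∀ v → v ∈ S ─ I → updateTokens M I f v ≤ length (L′ v)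
    long′ v v∈S─I rewrite updateTokens-∉ M I f (x∈p─q⇒x∉q S I v∈S─I)
      with v∈S ← p─q⊆p S I v∈S─I | v ∈? M
    ... | yes v∈M rewrite []=⇒lookup v∈M = ≤-trans (∸-monoˡ-≤ 1 (long v v∈S)) (length-remove col (unique v))
    ... | no v∉M rewrite ∉⇒lookup v∉M =
      subst (λ xs → f v ≤ length xs) (sym (remove-∉ col (λ col∈L[v] → v∉M (∈-subsetOf⁺ marked? (v∈S , col∈L[v]))))) (long v v∈S)

    extend : ColouringOn (S ─ I) L′ → ColouringOn S L
    extend (c′ , c′∈L′ , c′-proper) = c , c∈L , c-proper
      where
      c′∈L′-outside : ∀ v → v ∈ S → v ∉ I → c′ v ∈ₗ L′ v
      c′∈L′-outside v v∈S v∉I = c′∈L′ v (x∈p∧x∉q⇒x∈p─q v∈S v∉I)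

      c : Fin N → ℕ
      c v = if does (v ∈? I) then col else c′ v

      c∈L : ∀ v → v ∈ S → c v ∈ₗ L v
      c∈L v v∈S with v ∈? I
      ... | yes v∈I = proj₂ (∈-subsetOf⁻ marked? (I⊆M v∈I))
      ... | no v∉I = proj₁ (∈-remove⁻ col (L v) (c′∈L′-outside v v∈S v∉I))

      c-proper : ∀ u v → u ∈ S → v ∈ S → E u v → c u ≢ c v
      c-proper u v u∈S v∈S uEv with u ∈? I | v ∈? I
      ... | yes u∈I | yes v∈I = contradiction uEv (I-independent u v u∈I v∈I)
      ... | yes _   | no v∉I  = proj₂ (∈-remove⁻ col (L v) (c′∈L′-outside v v∈S v∉I)) ∘ sym
      ... | no u∉I  | yes _   = proj₂ (∈-remove⁻ col (L u) (c′∈L′-outside u u∈S u∉I))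
      ... | no u∉I  | no v∉I  = c′-proper u v (x∈p∧x∉q⇒x∈p─q u∈S u∉I) (x∈p∧x∉q⇒x∈p─q v∈S v∉I) uEv

paintable⇒choosable : ∀ N E f → Paintable N E f → Choosable N E f
paintable⇒choosable N E f paintable L unique length≡f
  with c , c∈L , c-proper ← paintableOn⇒colourableOn E paintable L unique (λ v _ → ≤-reflexive (sym (length≡f v)))
  = c , (λ v → c∈L v ∈⊤) , (λ u v → c-proper u v ∈⊤ ∈⊤)

-- Invariants give winning strategies for Painter

module _ {N : ℕ} where

  weight : Subset N → (Fin N → ℕ) → ℕ
  weight S h = sum (map (λ v → if lookup S v then suc (h v) else 0) (allFin N))

  updateTokens-≤ : ∀ M I (h : Fin N → ℕ) v → updateTokens M I h v ≤ h v
  updateTokens-≤ M I h v with lookup M v ∧ not (lookup I v)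
  ... | true = m∸n≤m (h v) 1
  ... | false = ≤-refl

  -- Each answer removes a marked vertex or takes one of its tokens.
  weight-move : ∀ {S h M I} → (∀ v → v ∈ S → 1 ≤ h v) → M ⊆ S → Nonempty M → I ⊆ M →
    weight (S ─ I) (updateTokens M I h) < weight S h
  weight-move {S} {h} {M} {I} tokens M⊆S (w , w∈M) I⊆M =
    sum-map-mono-< (∈-allFin w) decreases-at-w decreases
    where
    decreases : ∀ v → (if lookup (S ─ I) v then suc (updateTokens M I h v) else 0) ≤ (if lookup S v then suc (h v) else 0)
    decreases v with v ∈? S ─ I
    ... | yes v∈S─I rewrite []=⇒lookup v∈S─I | []=⇒lookup (p─q⊆p S I v∈S─I) = s≤s (updateTokens-≤ M I h v)
    ... | no v∉S─I rewrite ∉⇒lookup v∉S─I = z≤n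

    w∈S = M⊆S w∈M

    decreases-at-w : (if lookup (S ─ I) w then suc (updateTokens M I h w) else 0) < (if lookup S w then suc (h w) else 0)
    decreases-at-w rewrite []=⇒lookup w∈S with w ∈? I
    ... | yes w∈I rewrite ∉⇒lookup (λ w∈S─I → x∈p─q⇒x∉q S I w∈S─I w∈I) = s≤s z≤n
    ... | no w∉I rewrite []=⇒lookup (x∈p∧x∉q⇒x∈p─q w∈S w∉I) | updateTokens-∉ M I h w∉I | []=⇒lookup w∈M =
      s≤s (∸-monoʳ-< {h w} {1} {0} z<s (tokens w w∈S))

module _ {N : ℕ} (E : Fin N → Fin N → Set) (Good : Subset N → (Fin N → ℕ) → Set)
         (good⇒tokens : ∀ {S h} → Good S h → ∀ v → v ∈ S → 1 ≤ h v)
         (answer : ∀ {S h} → Good S h → ∀ M → M ⊆ S → Nonempty M →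
            Σ (Subset N) λ I → I ⊆ M × Independent E I × Good (S ─ I) (updateTokens M I h)) where

  good⇒paintableOn : ∀ {S h} → Good S h → PaintableOn E S h
  good⇒paintableOn good = bounded _ good ≤-refl
    where
    bounded : ∀ fuel {S h} → Good S h → weight S h < fuel → PaintableOn E S h
    bounded (suc fuel) good weight<fuel = step (good⇒tokens good) λ M M⊆S M≠∅ →
      let I , I⊆M , I-independent , good′ = answer good M M⊆S M≠∅
      in I , I⊆M , I-independent ,
         bounded fuel good′ (<-≤-trans (weight-move (good⇒tokens good) M⊆S M≠∅ I⊆M) (s≤s⁻¹ weight<fuel))

module Join (k m : ℕ) where

  clique : Fin k → Fin (k + m)
  clique a = a ↑ˡ m

  indep : Fin m → Fin (k + m)
  indep b = k ↑ʳ b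

  vertex-cases : ∀ v → (∃ λ a → v ≡ clique a) ⊎ (∃ λ b → v ≡ indep b)
  vertex-cases v with splitAt k v in eq
  ... | inj₁ a = inj₁ (a , trans (sym (Finₚ.join-splitAt k m v)) (cong (join k m) eq))
  ... | inj₂ b = inj₂ (b , trans (sym (Finₚ.join-splitAt k m v)) (cong (join k m) eq))

  clique≢indep : ∀ a b → clique a ≢ indep b
  clique≢indep a b eq with trans (sym (Finₚ.splitAt-↑ˡ k a m)) (trans (cong (splitAt k) eq) (Finₚ.splitAt-↑ʳ k m b))
  ... | ()

  IsIndep : Fin (k + m) → Set
  IsIndep v = ∃ λ b → v ≡ indep b

  isIndep? : Decidable IsIndep
  isIndep? v with vertex-cases v
  ... | inj₁ (a , refl) = no λ (b , clique≡indep) → clique≢indep a b clique≡indep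
  ... | inj₂ v≡indep = yes v≡indep

  clique-adjacent : ∀ {a a′} → a ≢ a′ → JoinAdj k m (clique a) (clique a′)
  clique-adjacent {a} {a′} a≢a′ rewrite Finₚ.splitAt-↑ˡ k a m | Finₚ.splitAt-↑ˡ k a′ m = a≢a′

  clique-irreflexive : ∀ a → ¬ JoinAdj k m (clique a) (clique a)
  clique-irreflexive a rewrite Finₚ.splitAt-↑ˡ k a m = λ a≢a → a≢a refl

  indep-clique-adjacent : ∀ b a → JoinAdj k m (indep b) (clique a)
  indep-clique-adjacent b a rewrite Finₚ.splitAt-↑ʳ k m b | Finₚ.splitAt-↑ˡ k a m = tt

  indep-nonadjacent : ∀ b b′ → ¬ JoinAdj k m (indep b) (indep b′)
  indep-nonadjacent b b′ rewrite Finₚ.splitAt-↑ʳ k m b | Finₚ.splitAt-↑ʳ k m b′ = λ ()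

  ext-clique : ∀ f a → ext k m f (clique a) ≡ f a
  ext-clique f a rewrite Finₚ.splitAt-↑ˡ k a m = refl

  ext-indep : ∀ f b → ext k m f (indep b) ≡ k
  ext-indep f b rewrite Finₚ.splitAt-↑ʳ k m b = refl

upSteps : ℕ → List Step → List ℕ
upSteps t [] = []
upSteps t (R ∷ p) = upSteps (suc t) p
upSteps t (U ∷ p) = t ∷ upSteps (suc t) p

upSteps-≥ : ∀ t p {s} → s ∈ₗ upSteps t p → t ≤ s
upSteps-≥ t (R ∷ p) s∈ = ≤-trans (n≤1+n t) (upSteps-≥ (suc t) p s∈)
upSteps-≥ t (U ∷ p) (here refl) = ≤-refl
upSteps-≥ t (U ∷ p) (there s∈) = ≤-trans (n≤1+n t) (upSteps-≥ (suc t) p s∈)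

Unique-upSteps : ∀ t p → Unique (upSteps t p)
Unique-upSteps t [] = []
Unique-upSteps t (R ∷ p) = Unique-upSteps (suc t) p
Unique-upSteps t (U ∷ p) =
  All.tabulate (λ s∈ t≡s → 1+n≰n (subst (suc t ≤_) (sym t≡s) (upSteps-≥ (suc t) p s∈))) ∷ Unique-upSteps (suc t) p

endsAt⇒length-upSteps : ∀ {i j a b} t p → T (endsAt i j p a b) → j + length (upSteps t p) ≡ b
endsAt⇒length-upSteps {i} {j} {a} {b} t [] ends =
  trans (+-identityʳ j) (≡ᵇ⇒≡ j b (proj₂ (Equivalence.to T-∧ ends)))
endsAt⇒length-upSteps t (R ∷ p) ends = endsAt⇒length-upSteps (suc t) p ends
endsAt⇒length-upSteps {j = j} t (U ∷ p) ends = trans (+-suc j _) (endsAt⇒length-upSteps (suc t) p ends)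

∈-allPaths : ∀ p → p ∈ₗ allPaths (length p)
∈-allPaths [] = here refl
∈-allPaths (s ∷ p) = ∈-concatMap⁺ (λ q → (R ∷ q) ∷ (U ∷ q) ∷ []) (Any.map (λ { refl → step∈ s }) (∈-allPaths p))
  where
  step∈ : ∀ s → s ∷ p ∈ₗ (R ∷ p) ∷ (U ∷ p) ∷ []
  step∈ R = here refl
  step∈ U = there (here refl)

i≤a-b⇔i+b≤a : ∀ i a b → (ℤ.+ i ℤ.≤ ℤ.+ a ℤ.- ℤ.+ b) ⇔ (i + b ≤ a)
i≤a-b⇔i+b≤a i a b rewrite ℤₚ.[+m]-[+n]≡m⊖n a b with b ≤? a
... | yes b≤a rewrite ℤₚ.⊖-≥ b≤a =
  mk⇔ (λ { (ℤ.+≤+ i≤a∸b) → m≤o∸n⇒m+n≤o i b≤a i≤a∸b }) (λ i+b≤a → ℤ.+≤+ (m+n≤o⇒m≤o∸n i i+b≤a))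
... | no b≰a = mk⇔ (λ i≤a⊖b → contradiction (ℤₚ.≤-<-trans (ℤ.+≤+ z≤n) (ℤₚ.≤-<-trans i≤a⊖b a⊖b<0)) (ℤₚ.<-irrefl refl))
                  (λ i+b≤a → contradiction (≤-trans (m≤n+m b i) i+b≤a) b≰a)
  where
  a⊖b<0 : a ℤ.⊖ b ℤ.< ℤ.0ℤ
  a⊖b<0 = subst (a ℤ.⊖ b ℤ.<_) (ℤₚ.n⊖n≡0 a) (ℤₚ.⊖-monoʳ->-< a (≰⇒> b≰a))

xvec≡⊖ : ∀ {N} (f : Fin N → ℕ) k → xvec f k ≡ f k ℤ.⊖ suc (toℕ k)
xvec≡⊖ f k = ℤₚ.[+m]-[+n]≡m⊖n (f k) (suc (toℕ k))

T-okAt-xvec : ∀ {N} (f : Fin N → ℕ) i j →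
  T (okAt (xvec f) i j) ⇔ ((j<N : j < N) → i + suc j ≤ f (fromℕ< j<N))
T-okAt-xvec {N} f i j with j <? N
... | no j≮N = mk⇔ (λ _ j<N → contradiction j<N j≮N) (λ _ → tt)
... | yes j<N with ℤ.+ i ℤ.≤? xvec f (fromℕ< j<N)
...   | yes i≤x = mk⇔ (λ _ _ → subst (λ t → i + suc t ≤ f (fromℕ< j<N)) (Finₚ.toℕ-fromℕ< j<N) (to i≤x)) (λ _ → tt)
  where open Equivalence (i≤a-b⇔i+b≤a i (f (fromℕ< j<N)) (suc (toℕ (fromℕ< j<N))))
...   | no i≰x = mk⇔ (λ ()) (λ le → contradiction (from (subst (λ t → i + suc t ≤ f (fromℕ< j<N)) (sym (Finₚ.toℕ-fromℕ< j<N)) (le j<N))) i≰x)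
  where open Equivalence (i≤a-b⇔i+b≤a i (f (fromℕ< j<N)) (suc (toℕ (fromℕ< j<N))))

ψ-nonnegative : ∀ {n} (x : Fin (suc n) → ℤ) a → x (fromℕ n) ≡ ℤ.+ a → ψ x ≡ countDominated x a (suc n)
ψ-nonnegative x a x[last]≡a rewrite x[last]≡a = refl

ψ-negative : ∀ {n} (x : Fin (suc n) → ℤ) a → x (fromℕ n) ≡ -[1+ a ] → ψ x ≡ 0
ψ-negative x a x[last]≡-1-a rewrite x[last]≡-1-a = refl

module _ {n : ℕ} (f : Fin (suc n) → ℕ) where

  xvec-last-≥ : suc n ≤ f (fromℕ n) → xvec f (fromℕ n) ≡ ℤ.+ (f (fromℕ n) ∸ suc n)
  xvec-last-≥ n<f rewrite xvec≡⊖ f (fromℕ n) | Finₚ.toℕ-fromℕ n = ℤₚ.⊖-≥ n<f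

  xvec-last-< : f (fromℕ n) ≤ n → xvec f (fromℕ n) ≡ -[1+ n ∸ f (fromℕ n) ]
  xvec-last-< f≤n rewrite xvec≡⊖ f (fromℕ n) | Finₚ.toℕ-fromℕ n | ℤₚ.⊖-< (s≤s f≤n) | +-∸-assoc 1 f≤n = refl

-- Choosability forces m < ψ

module Image {k : ℕ} (g : Fin k → ℕ) where

  InImage : ℕ → Set
  InImage t = ∃ λ a → g a ≡ t

  inImage? : Decidable InImage
  inImage? t = Finₚ.any? (λ a → g a ≟ t)

  imageBelow : ℕ → List ℕ
  imageBelow zero = []
  imageBelow (suc t) with inImage? t
  ... | yes _ = t ∷ imageBelow t
  ... | no _ = imageBelow t

  ∈-imageBelow⁻ : ∀ t {s} → s ∈ₗ imageBelow t → InImage s × s < t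
  ∈-imageBelow⁻ (suc t) s∈ with inImage? t
  ∈-imageBelow⁻ (suc t) (here refl) | yes t∈g = t∈g , ≤-refl
  ∈-imageBelow⁻ (suc t) (there s∈) | yes _ = map₂ m≤n⇒m≤1+n (∈-imageBelow⁻ t s∈)
  ∈-imageBelow⁻ (suc t) s∈ | no _ = map₂ m≤n⇒m≤1+n (∈-imageBelow⁻ t s∈)

  ∈-imageBelow⁺ : ∀ t {s} → InImage s → s < t → s ∈ₗ imageBelow t
  ∈-imageBelow⁺ (suc t) {s} s∈g s<1+t with inImage? t | s ≟ t
  ... | yes _   | yes refl = here refl
  ... | no t∉g  | yes refl = contradiction s∈g t∉g
  ... | yes _   | no s≢t = there (∈-imageBelow⁺ t s∈g (≤∧≢⇒< (s≤s⁻¹ s<1+t) s≢t))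
  ... | no _    | no s≢t = ∈-imageBelow⁺ t s∈g (≤∧≢⇒< (s≤s⁻¹ s<1+t) s≢t)

  Unique-imageBelow : ∀ t → Unique (imageBelow t)
  Unique-imageBelow zero = []
  Unique-imageBelow (suc t) with inImage? t
  ... | yes _ = All.tabulate (λ s∈ t≡s → <-irrefl (sym t≡s) (proj₂ (∈-imageBelow⁻ t s∈))) ∷ Unique-imageBelow t
  ... | no _ = Unique-imageBelow t

  length-imageBelow≤k : ∀ t → length (imageBelow t) ≤ k
  length-imageBelow≤k t = subst (length (imageBelow t) ≤_) (length-tabulate g)
    (Unique-⊆⇒length-≤ (Unique-imageBelow t) λ s∈ →
      let (a , ga≡s) , _ = ∈-imageBelow⁻ t s∈ in subst (_∈ₗ tabulateₗ g) ga≡s (∈-tabulate⁺ a))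

  length-imageBelow≤t : ∀ t → length (imageBelow t) ≤ t
  length-imageBelow≤t t = subst (length (imageBelow t) ≤_) (length-upTo t)
    (Unique-⊆⇒length-≤ (Unique-imageBelow t) (∈-upTo⁺ ∘ proj₂ ∘ ∈-imageBelow⁻ t))

  length-imageBelow-∈ : ∀ {t} → InImage t → length (imageBelow (suc t)) ≡ suc (length (imageBelow t))
  length-imageBelow-∈ {t} t∈g with inImage? t
  ... | yes _ = refl
  ... | no t∉g = contradiction t∈g t∉g

  length-imageBelow-∉ : ∀ {t} → ¬ InImage t → length (imageBelow (suc t)) ≡ length (imageBelow t)
  length-imageBelow-∉ {t} t∉g with inImage? t
  ... | yes t∈g = contradiction t∈g t∉g
  ... | no _ = refl

  imagePath : ℕ → ℕ → List Step
  imagePath t zero = []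
  imagePath t (suc L) with inImage? t
  ... | yes _ = U ∷ imagePath (suc t) L
  ... | no _ = R ∷ imagePath (suc t) L

  length-imagePath : ∀ t L → length (imagePath t L) ≡ L
  length-imagePath t zero = refl
  length-imagePath t (suc L) with inImage? t
  ... | yes _ = cong suc (length-imagePath (suc t) L)
  ... | no _ = cong suc (length-imagePath (suc t) L)

  upSteps-imagePath : ∀ t L {s} → s ∈ₗ upSteps t (imagePath t L) → InImage s
  upSteps-imagePath t (suc L) s∈ with inImage? t
  upSteps-imagePath t (suc L) (here refl) | yes t∈g = t∈g
  upSteps-imagePath t (suc L) (there s∈) | yes _ = upSteps-imagePath (suc t) L s∈
  upSteps-imagePath t (suc L) s∈ | no _ = upSteps-imagePath (suc t) L s∈

module _ (n : ℕ) (f : Fin (suc n) → ℕ) (f-mono : ∀ i j → i ≤ᶠ j → f i ≤ f j) where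

  private
    last width : ℕ
    last = f (fromℕ n)
    width = last ∸ suc n

  module ColouringPath (g : Fin (suc n) → ℕ) (g-injective : ∀ {a b} → g a ≡ g b → a ≡ b)
                      (g<f : ∀ a → g a < f a) where
    open Image g

    -- the colours of the clique vertices up to a are distinct and below f a
    ≤-length-imageBelow : ∀ t a → f a ≤ t → suc (toℕ a) ≤ length (imageBelow t)
    ≤-length-imageBelow t a fa≤t = subst (_≤ length (imageBelow t)) (length-tabulate h)
      (Unique-⊆⇒length-≤ (tabulate⁺ h-injective) h⊆imageBelow)
      where
      a<N = Finₚ.toℕ<n a
      h : Fin (suc (toℕ a)) → ℕ
      h u = g (inject≤ u a<N)
      h-injective : ∀ {u u′} → h u ≡ h u′ → u ≡ u′
      h-injective = Finₚ.inject≤-injective a<N a<N _ _ ∘ g-injective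
      h⊆imageBelow : tabulateₗ h ⊆ₗ imageBelow t
      h⊆imageBelow s∈ with u , refl ← ∈-tabulate⁻ {f = h} s∈ = ∈-imageBelow⁺ t (_ , refl) (begin-strict
        h u                  <⟨ g<f (inject≤ u a<N) ⟩
        f (inject≤ u a<N)    ≤⟨ f-mono _ a (subst (_≤ toℕ a) (sym (Finₚ.toℕ-inject≤ u a<N)) (s≤s⁻¹ (Finₚ.toℕ<n u))) ⟩
        f a                  ≤⟨ fa≤t ⟩
        t                    ∎)
        where open ≤-Reasoning

    okAt-imagePath : ∀ i j → j ≡ length (imageBelow (i + j)) → T (okAt (xvec f) i j)
    okAt-imagePath i j j≡# = Equivalence.from (T-okAt-xvec f i j) λ j<N → ≮⇒≥ λ fk<i+1+j →
      let k = fromℕ< j<N in 1+n≰n (begin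
        suc j                     ≡⟨ cong suc (Finₚ.toℕ-fromℕ< j<N) ⟨
        suc (toℕ k)               ≤⟨ ≤-length-imageBelow (i + j) k (s≤s⁻¹ (subst (f k <_) (+-suc i j) fk<i+1+j)) ⟩
        length (imageBelow (i + j)) ≡⟨ j≡# ⟨
        j                         ∎)
      where open ≤-Reasoning

    length-imageBelow-last : length (imageBelow last) ≡ suc n
    length-imageBelow-last = ≤-antisym (length-imageBelow≤k last)
      (subst (λ t → suc t ≤ length (imageBelow last)) (Finₚ.toℕ-fromℕ n) (≤-length-imageBelow last (fromℕ n) ≤-refl))

    imagePath-accepted : ∀ L i j → j ≡ length (imageBelow (i + j)) → i + j + L ≡ last →
      T (dominated (xvec f) i j (imagePath (i + j) L)) × T (endsAt i j (imagePath (i + j) L) width (suc n))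
    imagePath-accepted zero i j j≡# i+j+0≡last =
      okAt-imagePath i j j≡# , Equivalence.from T-∧ (≡⇒≡ᵇ i width i≡width , ≡⇒≡ᵇ j (suc n) j≡1+n)
      where
      i+j≡last = trans (sym (+-identityʳ (i + j))) i+j+0≡last
      j≡1+n = trans j≡# (trans (cong (length ∘ imageBelow) i+j≡last) length-imageBelow-last)
      i≡width = trans (sym (m+n∸n≡m i j)) (cong₂ _∸_ i+j≡last j≡1+n)
    imagePath-accepted (suc L) i j j≡# i+j+1+L≡last with inImage? (i + j)
    ... | yes i+j∈g = Equivalence.from T-∧ (okAt-imagePath i j j≡# , proj₁ rest) , proj₂ rest
      where
      rest = subst (λ t → T (dominated (xvec f) i (suc j) (imagePath t L)) × T (endsAt i (suc j) (imagePath t L) width (suc n)))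
        (+-suc i j)
        (imagePath-accepted L i (suc j)
          (trans (cong suc j≡#) (trans (sym (length-imageBelow-∈ i+j∈g)) (cong (length ∘ imageBelow) (sym (+-suc i j)))))
          (trans (cong (_+ L) (+-suc i j)) (trans (sym (+-suc (i + j) L)) i+j+1+L≡last)))
    ... | no i+j∉g = Equivalence.from T-∧ (okAt-imagePath i j j≡# , proj₁ rest) , proj₂ rest
      where
      rest = imagePath-accepted L (suc i) j (trans j≡# (sym (length-imageBelow-∉ i+j∉g)))
        (trans (sym (+-suc (i + j) L)) i+j+1+L≡last)

  accepts : List Step → Bool
  accepts p = dominated (xvec f) 0 0 p ∧ endsAt 0 0 p width (suc n)

  dominatedPaths : List (List Step)
  dominatedPaths = filterᵇ accepts (allPaths (width + suc n))

  accepts-dominatedPaths : ∀ {p} → p ∈ₗ dominatedPaths → T (accepts p)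
  accepts-dominatedPaths = proj₂ ∘ ∈-filter⁻ (T? ∘ accepts) {xs = allPaths (width + suc n)}

  module _ (m : ℕ) where
    open Join (suc n) m

    pathColours : Fin m → List ℕ
    pathColours b with toℕ b <? length dominatedPaths
    ... | yes b<# = upSteps 0 (lookupₗ dominatedPaths (fromℕ< b<#))
    ... | no _ = upTo (suc n)

    listsFromPaths : Fin (suc n + m) → List ℕ
    listsFromPaths v with splitAt (suc n) v
    ... | inj₁ a = upTo (f a)
    ... | inj₂ b = pathColours b

    listsFromPaths-clique : ∀ a → listsFromPaths (clique a) ≡ upTo (f a)
    listsFromPaths-clique a rewrite Finₚ.splitAt-↑ˡ (suc n) a m = refl

    listsFromPaths-indep : ∀ b → listsFromPaths (indep b) ≡ pathColours b
    listsFromPaths-indep b rewrite Finₚ.splitAt-↑ʳ (suc n) m b = refl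

    Unique-listsFromPaths : ∀ v → Unique (listsFromPaths v)
    Unique-listsFromPaths v with splitAt (suc n) v
    ... | inj₁ a = upTo⁺ (f a)
    ... | inj₂ b with toℕ b <? length dominatedPaths
    ...   | yes b<# = Unique-upSteps 0 (lookupₗ dominatedPaths (fromℕ< b<#))
    ...   | no _ = upTo⁺ (suc n)

    length-listsFromPaths : ∀ v → length (listsFromPaths v) ≡ ext (suc n) m f v
    length-listsFromPaths v with splitAt (suc n) v
    ... | inj₁ a = length-upTo (f a)
    ... | inj₂ b with toℕ b <? length dominatedPaths
    ...   | yes b<# = endsAt⇒length-upSteps 0 (lookupₗ dominatedPaths (fromℕ< b<#))
                        (proj₂ (Equivalence.to T-∧ (accepts-dominatedPaths (∈-lookup {xs = dominatedPaths} (fromℕ< b<#)))))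
    ...   | no _ = length-upTo (suc n)

    choosable⇒<ψ : Choosable (suc n + m) (JoinAdj (suc n) m) (ext (suc n) m f) → m < ψ (xvec f)
    choosable⇒<ψ choosable = ≰⇒> ψ≰m
      where
      ψ≰m : ¬ ψ (xvec f) ≤ m
      ψ≰m ψ≤m with c , c∈L , c-proper ← choosable listsFromPaths Unique-listsFromPaths length-listsFromPaths
        = c-proper (indep b) (clique a) (indep-clique-adjacent b a) (sym ga≡c[b])
        where
        g : Fin (suc n) → ℕ
        g a = c (clique a)

        g-injective : ∀ {a a′} → g a ≡ g a′ → a ≡ a′
        g-injective {a} {a′} ga≡ga′ with a Finₚ.≟ a′
        ... | yes a≡a′ = a≡a′
        ... | no a≢a′ = contradiction ga≡ga′ (c-proper _ _ (clique-adjacent a≢a′))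

        g<f : ∀ a → g a < f a
        g<f a = ∈-upTo⁻ (subst (g a ∈ₗ_) (listsFromPaths-clique a) (c∈L (clique a)))

        open Image g
        open ColouringPath g g-injective g<f

        n<last : suc n ≤ last
        n<last = subst (_≤ last) length-imageBelow-last (length-imageBelow≤t last)

        p₀ : List Step
        p₀ = imagePath 0 last

        p₀∈dominatedPaths : p₀ ∈ₗ dominatedPaths
        p₀∈dominatedPaths = ∈-filter⁺ (T? ∘ accepts)
          (subst (λ L → p₀ ∈ₗ allPaths L) (trans (length-imagePath 0 last) (sym (m∸n+n≡m n<last))) (∈-allPaths p₀))
          (Equivalence.from T-∧ (imagePath-accepted last 0 0 refl refl))

        i = index p₀∈dominatedPaths

        i<m : toℕ i < m
        i<m = <-≤-trans (Finₚ.toℕ<n i) (subst (_≤ m) (ψ-nonnegative (xvec f) width (xvec-last-≥ f n<last)) ψ≤m)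

        b : Fin m
        b = fromℕ< i<m

        pathColours-b : pathColours b ≡ upSteps 0 p₀
        pathColours-b with toℕ b <? length dominatedPaths
        ... | yes b<# = cong (upSteps 0) (trans
              (cong (lookupₗ dominatedPaths) (Finₚ.toℕ-injective (trans (Finₚ.toℕ-fromℕ< b<#) (Finₚ.toℕ-fromℕ< i<m))))
              (sym (lookup-index p₀∈dominatedPaths)))
        ... | no b≮# = contradiction (subst (_< length dominatedPaths) (sym (Finₚ.toℕ-fromℕ< i<m)) (Finₚ.toℕ<n i)) b≮#

        c[b]∈image : InImage (c (indep b))
        c[b]∈image = upSteps-imagePath 0 last
          (subst (c (indep b) ∈ₗ_) (trans (listsFromPaths-indep b) pathColours-b) (c∈L (indep b)))

        a = proj₁ c[b]∈image
        ga≡c[b] = proj₂ c[b]∈image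

-- Counting increasing sequences

sumFrom : ℕ → ℕ → (ℕ → ℕ) → ℕ
sumFrom lo zero F = 0
sumFrom lo (suc k) F = F lo + sumFrom (suc lo) k F

sumRange : ℕ → ℕ → (ℕ → ℕ) → ℕ
sumRange lo hi F = sumFrom lo (hi ∸ lo) F

sumFrom-++ : ∀ lo k k′ F → sumFrom lo k F + sumFrom (lo + k) k′ F ≡ sumFrom lo (k + k′) F
sumFrom-++ lo zero k′ F = cong (λ l → sumFrom l k′ F) (+-identityʳ lo)
sumFrom-++ lo (suc k) k′ F = trans (+-assoc (F lo) _ _) (cong (F lo +_)
  (trans (cong (λ l → sumFrom (suc lo) k F + sumFrom l k′ F) (+-suc lo k)) (sumFrom-++ (suc lo) k k′ F)))

sumFrom-zero : ∀ lo k F → (∀ b → lo ≤ b → F b ≡ 0) → sumFrom lo k F ≡ 0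
sumFrom-zero lo zero F F≡0 = refl
sumFrom-zero lo (suc k) F F≡0 rewrite F≡0 lo ≤-refl = sumFrom-zero (suc lo) k F (λ b lo<b → F≡0 b (<⇒≤ lo<b))

sumFrom-+ : ∀ lo k F G → sumFrom lo k (λ b → F b + G b) ≡ sumFrom lo k F + sumFrom lo k G
sumFrom-+ lo zero F G = refl
sumFrom-+ lo (suc k) F G = trans (cong (F lo + G lo +_) (sumFrom-+ (suc lo) k F G)) (interchange (F lo) (G lo) _ _)

sumFrom-cong : ∀ lo k {F G} → (∀ b → F b ≡ G b) → sumFrom lo k F ≡ sumFrom lo k G
sumFrom-cong lo zero F≡G = refl
sumFrom-cong lo (suc k) F≡G = cong₂ _+_ (F≡G lo) (sumFrom-cong (suc lo) k F≡G)

sumFrom-mono : ∀ lo k {F G} → (∀ b → lo ≤ b → F b ≤ G b) → sumFrom lo k F ≤ sumFrom lo k G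
sumFrom-mono lo zero F≤G = z≤n
sumFrom-mono lo (suc k) F≤G = +-mono-≤ (F≤G lo ≤-refl) (sumFrom-mono (suc lo) k (λ b lo<b → F≤G b (<⇒≤ lo<b)))

sumFrom-truncate : ∀ lo k k′ F → (∀ b → lo + k′ ≤ b → F b ≡ 0) → sumFrom lo k F ≤ sumFrom lo k′ F
sumFrom-truncate lo zero k′ F F≡0 = z≤n
sumFrom-truncate lo (suc k) zero F F≡0
  rewrite sumFrom-zero lo (suc k) F (λ b lo≤b → F≡0 b (subst (_≤ b) (sym (+-identityʳ lo)) lo≤b)) = z≤n
sumFrom-truncate lo (suc k) (suc k′) F F≡0 = +-monoʳ-≤ (F lo)
  (sumFrom-truncate (suc lo) k k′ F (λ b lo+1+k′≤b → F≡0 b (subst (_≤ b) (sym (+-suc lo k′)) lo+1+k′≤b)))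

[n∸m]+[o∸n]≡o∸m : ∀ {m n o} → m ≤ n → n ≤ o → n ∸ m + (o ∸ n) ≡ o ∸ m
[n∸m]+[o∸n]≡o∸m {m} {n} {o} m≤n n≤o = begin
  n ∸ m + (o ∸ n) ≡⟨ +-comm (n ∸ m) (o ∸ n) ⟩
  o ∸ n + (n ∸ m) ≡⟨ +-∸-assoc (o ∸ n) m≤n ⟨
  o ∸ n + n ∸ m   ≡⟨ cong (_∸ m) (m∸n+n≡m n≤o) ⟩
  o ∸ m           ∎
  where open ≡-Reasoning

sumRange-split : ∀ lo mid hi F → lo ≤ mid → mid ≤ hi → sumRange lo mid F + sumRange mid hi F ≡ sumRange lo hi F
sumRange-split lo mid hi F lo≤mid mid≤hi = begin
  sumFrom lo (mid ∸ lo) F + sumFrom mid (hi ∸ mid) F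
    ≡⟨ cong (λ l → sumFrom lo (mid ∸ lo) F + sumFrom l (hi ∸ mid) F) (m+[n∸m]≡n lo≤mid) ⟨
  sumFrom lo (mid ∸ lo) F + sumFrom (lo + (mid ∸ lo)) (hi ∸ mid) F
    ≡⟨ sumFrom-++ lo (mid ∸ lo) (hi ∸ mid) F ⟩
  sumFrom lo (mid ∸ lo + (hi ∸ mid)) F
    ≡⟨ cong (λ k → sumFrom lo k F) ([n∸m]+[o∸n]≡o∸m lo≤mid mid≤hi) ⟩
  sumFrom lo (hi ∸ lo) F ∎
  where open ≡-Reasoning

sumRange-cons : ∀ lo hi F → lo < hi → sumRange lo hi F ≡ F lo + sumRange (suc lo) hi F
sumRange-cons lo hi F lo<hi = cong (λ k → sumFrom lo k F) (+-∸-assoc 1 lo<hi)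

sumRange-empty : ∀ lo hi F → hi ≤ lo → sumRange lo hi F ≡ 0
sumRange-empty lo hi F hi≤lo rewrite m≤n⇒m∸n≡0 hi≤lo = refl

sumRange-snoc : ∀ lo hi F → lo ≤ hi → sumRange lo (suc hi) F ≡ sumRange lo hi F + F hi
sumRange-snoc lo hi F lo≤hi = begin
  sumRange lo (suc hi) F                      ≡⟨ sumRange-split lo hi (suc hi) F lo≤hi (n≤1+n hi) ⟨
  sumRange lo hi F + sumFrom hi (suc hi ∸ hi) F ≡⟨ cong (λ k → sumRange lo hi F + sumFrom hi k F) (m+n∸n≡m 1 hi) ⟩
  sumRange lo hi F + (F hi + 0)                ≡⟨ cong (sumRange lo hi F +_) (+-identityʳ (F hi)) ⟩
  sumRange lo hi F + F hi                      ∎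
  where open ≡-Reasoning

sumRange-cong : ∀ lo hi {F G} → (∀ b → F b ≡ G b) → sumRange lo hi F ≡ sumRange lo hi G
sumRange-cong lo hi = sumFrom-cong lo (hi ∸ lo)

sumRange-mono : ∀ lo hi {F G} → (∀ b → lo ≤ b → F b ≤ G b) → sumRange lo hi F ≤ sumRange lo hi G
sumRange-mono lo hi = sumFrom-mono lo (hi ∸ lo)

sumRange-+ : ∀ lo hi F G → sumRange lo hi (λ b → F b + G b) ≡ sumRange lo hi F + sumRange lo hi G
sumRange-+ lo hi = sumFrom-+ lo (hi ∸ lo)

sumRange-zero : ∀ lo hi F → (∀ b → lo ≤ b → F b ≡ 0) → sumRange lo hi F ≡ 0
sumRange-zero lo hi = sumFrom-zero lo (hi ∸ lo)

sumRange-truncate : ∀ lo hi t F → (∀ b → t ≤ b → F b ≡ 0) → sumRange lo hi F ≤ sumRange lo t F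
sumRange-truncate lo hi t F F≡0 = sumFrom-truncate lo (hi ∸ lo) (t ∸ lo) F (λ b p → F≡0 b (≤-trans (m≤n+m∸n t lo) p))

sumRange-antimonoˡ : ∀ lo lo′ hi F → lo ≤ lo′ → sumRange lo′ hi F ≤ sumRange lo hi F
sumRange-antimonoˡ lo lo′ hi F lo≤lo′ with lo′ ≤? hi
... | yes lo′≤hi = subst (sumRange lo′ hi F ≤_) (sumRange-split lo lo′ hi F lo≤lo′ lo′≤hi) (m≤n+m _ _)
... | no lo′≰hi rewrite sumRange-empty lo′ hi F (≰⇒≥ lo′≰hi) = z≤n

-- #{lo ≤ b₁ < b₂ < ⋯ < b_k : b_j ≤ g_j} for gs = g₁ ∷ ⋯ ∷ g_k
countIncreasing : ℕ → List ℕ → ℕ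
countIncreasing lo [] = 1
countIncreasing lo (g ∷ gs) = sumRange lo (suc g) (λ b → countIncreasing (suc b) gs)

countIncreasing-antimonoˡ : ∀ lo lo′ gs → lo ≤ lo′ → countIncreasing lo′ gs ≤ countIncreasing lo gs
countIncreasing-antimonoˡ lo lo′ [] lo≤lo′ = ≤-refl
countIncreasing-antimonoˡ lo lo′ (g ∷ gs) lo≤lo′ = sumRange-antimonoˡ lo lo′ (suc g) _ lo≤lo′

countIncreasing-positive : ∀ lo gs → 0 < countIncreasing lo gs → ∀ {g} → g ∈ₗ gs → lo ≤ g
countIncreasing-positive lo (g ∷ gs) positive g∈ with lo ≤? g
... | no lo≰g = contradiction (sumRange-empty lo (suc g) _ (≰⇒> lo≰g)) (>⇒≢ positive)
... | yes lo≤g with g∈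
...   | here refl = lo≤g
...   | there g∈gs = ≤-trans (n≤1+n lo) (countIncreasing-positive (suc lo) gs tail-positive g∈gs)
  where
  tail-positive : 0 < countIncreasing (suc lo) gs
  tail-positive = n≢0⇒n>0 λ tail≡0 → >⇒≢ positive (n≤0⇒n≡0 (begin
    sumRange lo (suc g) (λ b → countIncreasing (suc b) gs)
      ≤⟨ sumRange-mono lo (suc g) (λ b lo≤b →
           ≤-trans (countIncreasing-antimonoˡ (suc lo) (suc b) gs (s≤s lo≤b)) (≤-reflexive tail≡0)) ⟩
    sumRange lo (suc g) (λ _ → 0)
      ≡⟨ sumRange-zero lo (suc g) (λ _ → 0) (λ _ _ → refl) ⟩
    0 ∎))
    where open ≤-Reasoning

when≤ : ℕ → ℕ → ℕ → ℕ
when≤ lo g X = if does (lo ≤? g) then X else 0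

when≤-yes : ∀ {lo g} X → lo ≤ g → when≤ lo g X ≡ X
when≤-yes {lo} {g} X lo≤g rewrite dec-true (lo ≤? g) lo≤g = refl

when≤-no : ∀ {lo g} X → ¬ lo ≤ g → when≤ lo g X ≡ 0
when≤-no {lo} {g} X lo≰g rewrite dec-false (lo ≤? g) lo≰g = refl

when≤-≤ : ∀ lo g X → when≤ lo g X ≤ X
when≤-≤ lo g X with lo ≤? g
... | yes lo≤g = ≤-reflexive (when≤-yes X lo≤g)
... | no lo≰g = subst (_≤ X) (sym (when≤-no X lo≰g)) z≤n

module Decrement {V : Set} (h : V → ℕ) (marked : V → Bool) where

  h′ : V → ℕ
  h′ v = if marked v then h v ∸ 1 else h v

  h≤1+h′ : ∀ v → h v ≤ suc (h′ v)
  h≤1+h′ v with marked v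
  ... | false = n≤1+n (h v)
  ... | true = m≤n+m∸n (h v) 1

  -- The sequences counted for h but not for h′: some marked b_j equals h_j.
  lost : ℕ → List V → ℕ
  lost lo [] = 0
  lost lo (v ∷ vs) = if marked v
    then sumRange lo (h v) (λ b → lost (suc b) vs) + when≤ lo (h v) (countIncreasing (suc (h v)) (map h vs))
    else sumRange lo (suc (h v)) (λ b → lost (suc b) vs)

  countIncreasing-decrement : ∀ lo vs → 1 ≤ lo →
    countIncreasing lo (map h vs) ≡ countIncreasing lo (map h′ vs) + lost lo vs
  countIncreasing-decrement lo [] _ = refl
  countIncreasing-decrement lo (v ∷ vs) 1≤lo with marked v
  ... | false = trans (sumRange-cong lo (suc (h v)) λ b → countIncreasing-decrement (suc b) vs (s≤s z≤n))
                      (sumRange-+ lo (suc (h v)) _ _)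
  ... | true with lo ≤? h v
  ...   | yes lo≤g = begin
    sumRange lo (suc g) C
      ≡⟨ sumRange-snoc lo g C lo≤g ⟩
    sumRange lo g C + C g
      ≡⟨ cong (_+ C g) (trans (sumRange-cong lo g λ b → countIncreasing-decrement (suc b) vs (s≤s z≤n)) (sumRange-+ lo g C′ L)) ⟩
    sumRange lo g C′ + sumRange lo g L + C g
      ≡⟨ +-assoc (sumRange lo g C′) _ _ ⟩
    sumRange lo g C′ + (sumRange lo g L + C g)
      ≡⟨ cong₂ (λ hi x → sumRange lo hi C′ + (sumRange lo g L + x)) (m+[n∸m]≡n (≤-trans 1≤lo lo≤g)) (when≤-yes (C g) lo≤g) ⟨
    sumRange lo (suc (g ∸ 1)) C′ + (sumRange lo g L + when≤ lo g (C g)) ∎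
    where
    open ≡-Reasoning
    g = h v
    C = λ b → countIncreasing (suc b) (map h vs)
    C′ = λ b → countIncreasing (suc b) (map h′ vs)
    L = λ b → lost (suc b) vs
  ...   | no lo≰g = begin
    sumRange lo (suc g) C
      ≡⟨ sumRange-empty lo (suc g) C (≰⇒> lo≰g) ⟩
    0
      ≡⟨ cong₂ _+_ (sumRange-empty lo (suc (g ∸ 1)) C′ (≤-trans (s≤s (m∸n≤m g 1)) (≰⇒> lo≰g)))
                   (cong₂ _+_ (sumRange-empty lo g L (<⇒≤ (≰⇒> lo≰g))) (when≤-no (C g) lo≰g)) ⟨
    sumRange lo (suc (g ∸ 1)) C′ + (sumRange lo g L + when≤ lo g (C g)) ∎
    where
    open ≡-Reasoning
    g = h v
    C = λ b → countIncreasing (suc b) (map h vs)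
    C′ = λ b → countIncreasing (suc b) (map h′ vs)
    L = λ b → lost (suc b) vs

  lost-vanishes : ∀ lo v vs → h v < lo → lost lo (v ∷ vs) ≡ 0
  lost-vanishes lo v vs g<lo with marked v
  ... | false = sumRange-empty lo (suc (h v)) _ g<lo
  ... | true = cong₂ _+_ (sumRange-empty lo (h v) _ (<⇒≤ g<lo)) (when≤-no _ (<⇒≱ g<lo))

  lost-≤ : ∀ lo v vs → lost lo (v ∷ vs) ≤ countIncreasing lo (map h′ vs)
  lost-≤ lo v [] with marked v
  ... | false rewrite sumRange-zero lo (suc (h v)) (λ b → lost (suc b) []) (λ _ _ → refl) = z≤n
  ... | true rewrite sumRange-zero lo (h v) (λ b → lost (suc b) []) (λ _ _ → refl) = when≤-≤ lo (h v) 1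
  lost-≤ lo v (w ∷ ws) = bound
    where
    L = λ b → lost (suc b) (w ∷ ws)
    C′ = λ b → countIncreasing (suc b) (map h′ ws)
    t = suc (h′ w)

    lost-prefix-≤ : ∀ hi → sumRange lo hi L ≤ sumRange lo t C′
    lost-prefix-≤ hi = ≤-trans
      (sumRange-truncate lo hi t L (λ b t≤b → lost-vanishes (suc b) w ws (s≤s (≤-trans (h≤1+h′ w) t≤b))))
      (sumRange-mono lo t (λ b _ → lost-≤ (suc b) w ws))

    bound : lost lo (v ∷ w ∷ ws) ≤ sumRange lo t C′
    bound with marked v
    ... | false = lost-prefix-≤ (suc (h v))
    ... | true with h v | lo ≤? h v
    ...   | g | no lo≰g = subst (_≤ sumRange lo t C′)
      (sym (cong₂ _+_ (sumRange-empty lo g L (<⇒≤ (≰⇒> lo≰g))) (when≤-no _ lo≰g))) z≤n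
    ...   | g | yes lo≤g = begin
      sumRange lo g L + when≤ lo g (countIncreasing (suc g) (map h (w ∷ ws)))
        ≡⟨ cong (sumRange lo g L +_) (when≤-yes _ lo≤g) ⟩
      sumRange lo g L + countIncreasing (suc g) (map h (w ∷ ws))
        ≡⟨ cong (sumRange lo g L +_) (countIncreasing-decrement (suc g) (w ∷ ws) (s≤s z≤n)) ⟩
      sumRange lo g L + (sumRange (suc g) t C′ + L g)
        ≡⟨ cong (sumRange lo g L +_) (+-comm (sumRange (suc g) t C′) (L g)) ⟩
      sumRange lo g L + (L g + sumRange (suc g) t C′)
        ≡⟨ +-assoc (sumRange lo g L) (L g) _ ⟨
      sumRange lo g L + L g + sumRange (suc g) t C′
        ≡⟨ cong (_+ sumRange (suc g) t C′) (sumRange-snoc lo g L lo≤g) ⟨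
      sumRange lo (suc g) L + sumRange (suc g) t C′
        ≤⟨ finish (suc g ≤? t) ⟩
      sumRange lo t C′ ∎
      where
      open ≤-Reasoning
      finish : Dec (suc g ≤ t) → sumRange lo (suc g) L + sumRange (suc g) t C′ ≤ sumRange lo t C′
      finish (yes g<t) = ≤-trans (+-monoˡ-≤ _ (sumRange-mono lo (suc g) (λ b _ → lost-≤ (suc b) w ws)))
                                 (≤-reflexive (sumRange-split lo (suc g) t C′ (≤-trans lo≤g (n≤1+n g)) g<t))
      finish (no g≮t) rewrite sumRange-empty (suc g) t C′ (≰⇒≥ g≮t) | +-identityʳ (sumRange lo (suc g) L) =
        lost-prefix-≤ (suc g)

  countIncreasing≤decrement+delete : ∀ lo pre v post → 1 ≤ lo → All (λ u → marked u ≡ false) pre →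
    countIncreasing lo (map h (pre ++ v ∷ post)) ≤
    countIncreasing lo (map h′ (pre ++ v ∷ post)) + countIncreasing lo (map h′ (pre ++ post))
  countIncreasing≤decrement+delete lo [] v post 1≤lo [] rewrite countIncreasing-decrement lo (v ∷ post) 1≤lo =
    +-monoʳ-≤ (countIncreasing lo (map h′ (v ∷ post))) (lost-≤ lo v post)
  countIncreasing≤decrement+delete lo (u ∷ pre) v post 1≤lo (u-unmarked ∷ pre-unmarked) = begin
    sumRange lo (suc (h u)) (λ b → countIncreasing (suc b) (map h (pre ++ v ∷ post)))
      ≤⟨ sumRange-mono lo (suc (h u)) (λ b _ → countIncreasing≤decrement+delete (suc b) pre v post (s≤s z≤n) pre-unmarked) ⟩
    sumRange lo (suc (h u)) (λ b → C b + D b)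
      ≡⟨ sumRange-+ lo (suc (h u)) C D ⟩
    sumRange lo (suc (h u)) C + sumRange lo (suc (h u)) D
      ≡⟨ cong (λ g → sumRange lo (suc g) C + sumRange lo (suc g) D) h′u≡hu ⟨
    sumRange lo (suc (h′ u)) C + sumRange lo (suc (h′ u)) D ∎
    where
    open ≤-Reasoning
    C = λ b → countIncreasing (suc b) (map h′ (pre ++ v ∷ post))
    D = λ b → countIncreasing (suc b) (map h′ (pre ++ post))
    h′u≡hu : h′ u ≡ h u
    h′u≡hu rewrite u-unmarked = refl

-- Dominated paths and increasing sequences

length-filterᵇ-steps : ∀ (P : List Step → Bool) ps →
  length (filterᵇ P (concatMap (λ p → (R ∷ p) ∷ (U ∷ p) ∷ []) ps)) ≡
  length (filterᵇ (P ∘ (R ∷_)) ps) + length (filterᵇ (P ∘ (U ∷_)) ps)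
length-filterᵇ-steps P [] = refl
length-filterᵇ-steps P (p ∷ ps) with ih ← length-filterᵇ-steps P ps | P (R ∷ p)
length-filterᵇ-steps P (p ∷ ps) | true with P (U ∷ p)
... | true = cong suc (trans (cong suc ih) (sym (+-suc _ _)))
... | false = cong suc ih
length-filterᵇ-steps P (p ∷ ps) | false with P (U ∷ p)
... | true = trans (cong suc ih) (sym (+-suc _ _))
... | false = ih

module DominatedPaths {N : ℕ} (x : Fin N → ℤ) (a b : ℕ) where

  paths : ℕ → ℕ → ℕ → ℕ
  paths i j L = length (filterᵇ (λ p → dominated x i j p ∧ endsAt i j p a b) (allPaths L))

  paths-step : ∀ i j L → T (okAt x i j) → paths i j (suc L) ≡ paths (suc i) j L + paths i (suc j) L
  paths-step i j L ok = trans (length-filterᵇ-steps (λ p → dominated x i j p ∧ endsAt i j p a b) (allPaths L))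
                              (okAt-true (okAt x i j) (Equivalence.to T-≡ ok))
    where
    okAt-true : ∀ o → o ≡ true →
      length (filterᵇ (λ p → (o ∧ dominated x (suc i) j p) ∧ endsAt (suc i) j p a b) (allPaths L)) +
      length (filterᵇ (λ p → (o ∧ dominated x i (suc j) p) ∧ endsAt i (suc j) p a b) (allPaths L)) ≡
      paths (suc i) j L + paths i (suc j) L
    okAt-true .true refl = refl

  paths-blocked : ∀ i j L → ¬ T (okAt x i j) → paths i j (suc L) ≡ 0
  paths-blocked i j L blocked = trans (length-filterᵇ-steps (λ p → dominated x i j p ∧ endsAt i j p a b) (allPaths L))
                                      (okAt-false (okAt x i j) blocked)
    where
    okAt-false : ∀ o → ¬ T o →
      length (filterᵇ (λ p → (o ∧ dominated x (suc i) j p) ∧ endsAt (suc i) j p a b) (allPaths L)) +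
      length (filterᵇ (λ p → (o ∧ dominated x i (suc j) p) ∧ endsAt i (suc j) p a b) (allPaths L)) ≡ 0
    okAt-false true blocked = contradiction tt blocked
    okAt-false false _ = cong₂ _+_ nothing-accepted nothing-accepted
      where
      nothing-accepted = cong length (filter-none (T? ∘ λ _ → false) (All.universal (λ _ ()) (allPaths L)))

  paths-zero : ∀ i j → j ≢ b → paths i j 0 ≡ 0
  paths-zero i j j≢b = cong length (filter-reject (T? ∘ λ p → dominated x i j p ∧ endsAt i j p a b) {x = []} {xs = []}
    λ ok → j≢b (≡ᵇ⇒≡ j b (proj₂ (Equivalence.to T-∧ (proj₂ (Equivalence.to (T-∧ {okAt x i j}) ok))))))

  paths-above : ∀ L i j → b < j → paths i j L ≡ 0
  paths-above zero i j b<j = paths-zero i j (≢-sym (<⇒≢ b<j))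
  paths-above (suc L) i j b<j with T? (okAt x i j)
  ... | yes ok = trans (paths-step i j L ok) (cong₂ _+_ (paths-above L (suc i) j b<j) (paths-above L i (suc j) (m≤n⇒m≤1+n b<j)))
  ... | no blocked = paths-blocked i j L blocked

  module _ (b≡N : b ≡ N) where

    okAt-top : ∀ i → T (okAt x i b)
    okAt-top i with b <? N
    ... | yes b<N = contradiction b≡N (<⇒≢ b<N)
    ... | no _ = tt

    paths-top : ∀ L i → i + L ≡ a → paths i b L ≡ 1
    paths-top zero i i+0≡a = cong length (filter-accept (T? ∘ λ p → dominated x i b p ∧ endsAt i b p a b) {x = []} {xs = []}
      (Equivalence.from T-∧ (okAt-top i , Equivalence.from T-∧ (≡⇒≡ᵇ i a (trans (sym (+-identityʳ i)) i+0≡a) , ≡⇒≡ᵇ b b refl))))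
    paths-top (suc L) i i+1+L≡a = begin
      paths i b (suc L)                 ≡⟨ paths-step i b L (okAt-top i) ⟩
      paths (suc i) b L + paths i (suc b) L ≡⟨ cong₂ _+_ (paths-top L (suc i) (trans (sym (+-suc i L)) i+1+L≡a)) (paths-above L i (suc b) ≤-refl) ⟩
      1 ∎
      where open ≡-Reasoning

module _ {n : ℕ} (f : Fin (suc n) → ℕ) where

  private
    last width : ℕ
    last = f (fromℕ n)
    width = last ∸ suc n

  open DominatedPaths (xvec f) width (suc n)

  -- The up-steps still to come, at times counted from 1, form the increasing sequence.
  paths≡countIncreasing : suc n ≤ last → ∀ L i j → j ≤ suc n → i + j + L ≡ last →
    paths i j L ≡ countIncreasing (suc (i + j)) (drop j (tabulateₗ f))
  paths≡countIncreasing n<last L i j j≤1+n i+j+L≡last with j <? suc n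
  ... | no j≮1+n rewrite ≤-antisym j≤1+n (≮⇒≥ j≮1+n) | drop-all (suc n) (tabulateₗ f) (≤-reflexive (length-tabulate f)) =
    paths-top refl L i (begin
      i + L               ≡⟨ m+n∸n≡m (i + L) (suc n) ⟨
      i + L + suc n ∸ suc n ≡⟨ cong (_∸ suc n) (trans (+-assoc i L (suc n)) (trans (cong (i +_) (+-comm L (suc n))) (sym (+-assoc i (suc n) L)))) ⟩
      i + suc n + L ∸ suc n ≡⟨ cong (_∸ suc n) i+j+L≡last ⟩
      width               ∎)
    where open ≡-Reasoning
  paths≡countIncreasing n<last zero i j j≤1+n i+j+0≡last | yes j<1+n =
    trans (paths-zero i j (<⇒≢ j<1+n)) (sym (n≤0⇒n≡0 (≮⇒≥ λ positive →
      1+n≰n (subst (λ t → suc t ≤ last) (trans (sym (+-identityʳ (i + j))) i+j+0≡last)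
        (countIncreasing-positive _ _ positive (last-∈-drop-tabulate f j (s≤s⁻¹ j<1+n)))))))
  paths≡countIncreasing n<last (suc L) i j j≤1+n i+j+1+L≡last | yes j<1+n
    rewrite drop-tabulate f j j<1+n with i + suc j ≤? f (fromℕ< j<1+n)
  ... | no i+1+j≰fj = trans
    (paths-blocked i j L λ ok → i+1+j≰fj (Equivalence.to (T-okAt-xvec f i j) ok j<1+n))
    (sym (sumRange-empty (suc (i + j)) (suc fj) _ (subst (λ t → suc fj ≤ t) (+-suc i j) (≰⇒> i+1+j≰fj))))
    where fj = f (fromℕ< j<1+n)
  ... | yes i+1+j≤fj = begin
    paths i j (suc L)
      ≡⟨ paths-step i j L (Equivalence.from (T-okAt-xvec f i j) (λ _ → i+1+j≤fj)) ⟩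
    paths (suc i) j L + paths i (suc j) L
      ≡⟨ cong₂ _+_ (paths≡countIncreasing n<last L (suc i) j j≤1+n (trans (sym (+-suc (i + j) L)) i+j+1+L≡last))
                   (paths≡countIncreasing n<last L i (suc j) j<1+n
                      (trans (cong (_+ L) (+-suc i j)) (trans (sym (+-suc (i + j) L)) i+j+1+L≡last))) ⟩
    countIncreasing (suc (suc (i + j))) (drop j (tabulateₗ f)) + C (i + suc j)
      ≡⟨ cong₂ _+_ (cong (countIncreasing (suc (suc (i + j)))) (drop-tabulate f j j<1+n)) (cong C (+-suc i j)) ⟩
    sumRange (suc (suc (i + j))) (suc fj) C + C (suc (i + j))
      ≡⟨ +-comm (sumRange (suc (suc (i + j))) (suc fj) C) _ ⟩
    C (suc (i + j)) + sumRange (suc (suc (i + j))) (suc fj) C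
      ≡⟨ sumRange-cons (suc (i + j)) (suc fj) C (s≤s (subst (_≤ fj) (+-suc i j) i+1+j≤fj)) ⟨
    sumRange (suc (i + j)) (suc fj) C ∎
    where
    open ≡-Reasoning
    fj = f (fromℕ< j<1+n)
    C = λ b → countIncreasing (suc b) (drop (suc j) (tabulateₗ f))

  ψ≤countIncreasing : ψ (xvec f) ≤ countIncreasing 1 (tabulateₗ f)
  ψ≤countIncreasing with suc n ≤? last
  ... | yes n<last = ≤-reflexive (trans (ψ-nonnegative (xvec f) width (xvec-last-≥ f n<last))
                                        (paths≡countIncreasing n<last (width + suc n) 0 0 z≤n (m∸n+n≡m n<last)))
  ... | no n≮last rewrite ψ-negative (xvec f) (n ∸ last) (xvec-last-< f (s≤s⁻¹ (≰⇒> n≮last))) = z≤n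

-- Painter's strategy on the join

module Painter (k m : ℕ) where
  open Join k m

  record Invariant (S : Subset (k + m)) (h : Fin (k + m) → ℕ) : Set where
    field
      cliqueLeft : List (Fin k)
      cliqueLeft-unique : Unique cliqueLeft
      cliqueLeft⇒∈ : ∀ {a} → a ∈ₗ cliqueLeft → clique a ∈ S
      ∈⇒cliqueLeft : ∀ {a} → clique a ∈ S → a ∈ₗ cliqueLeft
      threatened : List (Fin m)
      threatened-complete : ∀ {b} → indep b ∈ S → h (indep b) ≤ length cliqueLeft → b ∈ₗ threatened
      indep-tokens : ∀ {b} → indep b ∈ S → length cliqueLeft ≤ h (indep b)
      few-threatened : length threatened < countIncreasing 1 (map (h ∘ clique) cliqueLeft)

  invariant⇒tokens : ∀ {S h} → Invariant S h → ∀ v → v ∈ S → 1 ≤ h v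
  invariant⇒tokens {S} {h} inv v v∈S with vertex-cases v
  ... | inj₁ (a , refl) = countIncreasing-positive 1 (map (h ∘ clique) cliqueLeft) (≤-trans (s≤s z≤n) few-threatened)
                            (∈-map⁺ (h ∘ clique) (∈⇒cliqueLeft v∈S))
    where open Invariant inv
  ... | inj₂ (b , refl) = n≢0⇒n>0 λ h≡0 →
    no-clique-left cliqueLeft threatened
      (n≤0⇒n≡0 (subst (length cliqueLeft ≤_) h≡0 (indep-tokens v∈S)))
      few-threatened
      (threatened-complete v∈S (subst (_≤ length cliqueLeft) (sym h≡0) z≤n))
    where
    open Invariant inv
    no-clique-left : ∀ (as : List (Fin k)) (bs : List (Fin m)) → length as ≡ 0 →
      length bs < countIncreasing 1 (map (h ∘ clique) as) → b ∉ₗ bs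
    no-clique-left [] (_ ∷ _) _ (s≤s ()) _
    no-clique-left [] [] _ _ ()

  module Move {S h} (inv : Invariant S h) (M : Subset (k + m)) where
    open Invariant inv
    open Decrement (h ∘ clique) (λ a → lookup M (clique a))

    markedIndep : Fin m → Bool
    markedIndep b = lookup M (indep b)

    Answer : Set
    Answer = Σ (Subset (k + m)) λ I → I ⊆ M × Independent (JoinAdj k m) I × Invariant (S ─ I) (updateTokens M I h)

    markedIndep? : Decidable (λ v → v ∈ M × IsIndep v)
    markedIndep? v = v ∈? M ×-dec isIndep? v

    markedIndeps : Subset (k + m)
    markedIndeps = subsetOf markedIndep?

    colourMarkedIndeps : length (filterᵇ (not ∘ markedIndep) threatened) < countIncreasing 1 (map h′ cliqueLeft) → Answer
    colourMarkedIndeps few = I , proj₁ ∘ ∈-subsetOf⁻ markedIndep? , independent , record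
      { cliqueLeft = cliqueLeft
      ; cliqueLeft-unique = cliqueLeft-unique
      ; cliqueLeft⇒∈ = λ a∈ → x∈p∧x∉q⇒x∈p─q (cliqueLeft⇒∈ a∈) (clique∉I _)
      ; ∈⇒cliqueLeft = λ clique∈ → ∈⇒cliqueLeft (p─q⊆p S I clique∈)
      ; threatened = filterᵇ (not ∘ markedIndep) threatened
      ; threatened-complete = λ {b} indep∈ few-tokens → ∈-filter⁺ (T? ∘ not ∘ markedIndep)
          (threatened-complete (p─q⊆p S I indep∈) (subst (_≤ length cliqueLeft) (tokens-indep indep∈) few-tokens))
          (subst (T ∘ not) (sym (∉⇒lookup (unmarked indep∈))) tt)
      ; indep-tokens = λ indep∈ → subst (length cliqueLeft ≤_) (sym (tokens-indep indep∈)) (indep-tokens (p─q⊆p S I indep∈))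
      ; few-threatened = subst (λ gs → length (filterᵇ (not ∘ markedIndep) threatened) < countIncreasing 1 gs)
                               (sym (map-cong tokens-clique cliqueLeft)) few
      }
      where
      I = markedIndeps

      independent : Independent (JoinAdj k m) I
      independent u v u∈I v∈I with proj₂ (∈-subsetOf⁻ markedIndep? u∈I) | proj₂ (∈-subsetOf⁻ markedIndep? v∈I)
      ... | b , refl | b′ , refl = indep-nonadjacent b b′

      clique∉I : ∀ a → clique a ∉ I
      clique∉I a clique∈ = clique≢indep a _ (proj₂ (proj₂ (∈-subsetOf⁻ markedIndep? clique∈)))

      tokens-clique : ∀ a → updateTokens M I h (clique a) ≡ h′ a
      tokens-clique a = updateTokens-∉ M I h (clique∉I a)

      unmarked : ∀ {b} → indep b ∈ S ─ I → indep b ∉ M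
      unmarked indep∈ indep∈M = x∈p─q⇒x∉q S I indep∈ (∈-subsetOf⁺ markedIndep? (indep∈M , _ , refl))

      tokens-indep : ∀ {b} → indep b ∈ S ─ I → updateTokens M I h (indep b) ≡ h (indep b)
      tokens-indep indep∈ rewrite updateTokens-∉ M I h (x∈p─q⇒x∉q S I indep∈) | ∉⇒lookup (unmarked indep∈) = refl

    colourClique : ∀ pre v post → cliqueLeft ≡ pre ++ v ∷ post → lookup M (clique v) ≡ true →
      length (filterᵇ markedIndep threatened) < countIncreasing 1 (map h′ (pre ++ post)) → Answer
    colourClique pre v post split v-marked few = I , I⊆M , independent , record
      { cliqueLeft = pre ++ post
      ; cliqueLeft-unique = proj₁ deleted
      ; cliqueLeft⇒∈ = λ a∈ → x∈p∧x∉q⇒x∈p─q (cliqueLeft⇒∈ (subst (_ ∈ₗ_) (sym split) (∈-insert pre a∈))) (clique∉I (≢v a∈))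
      ; ∈⇒cliqueLeft = λ clique∈ → ∈-delete pre (subst (_ ∈ₗ_) split (∈⇒cliqueLeft (p─q⊆p S I clique∈)))
                                     λ { refl → x∈p─q⇒x∉q S I clique∈ (x∈⁅x⁆ (clique v)) }
      ; threatened = filterᵇ markedIndep threatened
      ; threatened-complete = threatened-complete′
      ; indep-tokens = indep-tokens′
      ; few-threatened = subst (λ gs → length (filterᵇ markedIndep threatened) < countIncreasing 1 gs)
                               (sym (map-cong-local (All.tabulate (tokens-clique ∘ ≢v)))) few
      }
      where
      I = ⁅ clique v ⁆

      I⊆M : I ⊆ M
      I⊆M u∈I rewrite x∈⁅y⁆⇒x≡y (clique v) u∈I = lookup⇒[]= (clique v) M v-marked

      independent : Independent (JoinAdj k m) I
      independent u w u∈I w∈I rewrite x∈⁅y⁆⇒x≡y (clique v) u∈I | x∈⁅y⁆⇒x≡y (clique v) w∈I = clique-irreflexive v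

      deleted = Unique-delete pre (subst Unique split cliqueLeft-unique)

      ≢v : ∀ {a} → a ∈ₗ pre ++ post → a ≢ v
      ≢v a∈ refl = proj₂ deleted a∈

      clique∉I : ∀ {a} → a ≢ v → clique a ∉ I
      clique∉I a≢v clique∈ = a≢v (Finₚ.↑ˡ-injective m _ v (x∈⁅y⁆⇒x≡y (clique v) clique∈))

      tokens-clique : ∀ {a} → a ≢ v → updateTokens M I h (clique a) ≡ h′ a
      tokens-clique a≢v = updateTokens-∉ M I h (clique∉I a≢v)

      tokens-indep : ∀ b → updateTokens M I h (indep b) ≡ (if markedIndep b then h (indep b) ∸ 1 else h (indep b))
      tokens-indep b = updateTokens-∉ M I h (λ indep∈ → clique≢indep v b (sym (x∈⁅y⁆⇒x≡y (clique v) indep∈)))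

      length-left : length cliqueLeft ≡ suc (length (pre ++ post))
      length-left = trans (cong length split) (length-delete pre)

      threatened-complete′ : ∀ {b} → indep b ∈ S ─ I → updateTokens M I h (indep b) ≤ length (pre ++ post) →
        b ∈ₗ filterᵇ markedIndep threatened
      threatened-complete′ {b} indep∈ few-tokens rewrite tokens-indep b with markedIndep b in marked
      ... | true = ∈-filter⁺ (T? ∘ markedIndep) (threatened-complete (p─q⊆p S I indep∈)
                     (subst (h (indep b) ≤_) (sym length-left) (≤-trans (m≤n+m∸n (h (indep b)) 1) (s≤s few-tokens)))) (subst T (sym marked) tt)
      ... | false = contradiction (≤-trans (subst (_≤ h (indep b)) length-left (indep-tokens (p─q⊆p S I indep∈))) few-tokens)
                                  1+n≰n

      indep-tokens′ : ∀ {b} → indep b ∈ S ─ I → length (pre ++ post) ≤ updateTokens M I h (indep b)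
      indep-tokens′ {b} indep∈ rewrite tokens-indep b with markedIndep b
      ... | true = subst (_≤ h (indep b) ∸ 1) (cong (_∸ 1) length-left) (∸-monoˡ-≤ 1 (indep-tokens (p─q⊆p S I indep∈)))
      ... | false = ≤-trans (n≤1+n _) (subst (_≤ h (indep b)) length-left (indep-tokens (p─q⊆p S I indep∈)))

    answer : Answer
    answer with firstSplit (λ a → lookup M (clique a)) cliqueLeft
    ... | inj₂ none-marked = colourMarkedIndeps (begin-strict
      length (filterᵇ (not ∘ markedIndep) threatened) ≤⟨ length-filter (T? ∘ not ∘ markedIndep) threatened ⟩
      length threatened                              <⟨ few-threatened ⟩
      countIncreasing 1 (map (h ∘ clique) cliqueLeft) ≡⟨ cong (countIncreasing 1) (map-cong-local (All.map h′-unmarked none-marked)) ⟨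
      countIncreasing 1 (map h′ cliqueLeft)          ∎)
      where
      open ≤-Reasoning
      h′-unmarked : ∀ {a} → lookup M (clique a) ≡ false → h′ a ≡ h (clique a)
      h′-unmarked unmarked rewrite unmarked = refl
    ... | inj₁ (pre , v , post , split , pre-unmarked , v-marked)
      with length (filterᵇ markedIndep threatened) <? countIncreasing 1 (map h′ (pre ++ post))
    ...   | yes few = colourClique pre v post split v-marked few
    ...   | no many = colourMarkedIndeps (+-cancelˡ-< #marked #unmarked _ (begin-strict
      #marked + #unmarked                                          ≡⟨ length-filterᵇ-partition markedIndep threatened ⟩
      length threatened                                             <⟨ few-threatened ⟩
      countIncreasing 1 (map (h ∘ clique) cliqueLeft)               ≤⟨ subst (λ as → countIncreasing 1 (map (h ∘ clique) as) ≤
                                                                                 countIncreasing 1 (map h′ as) + countIncreasing 1 (map h′ (pre ++ post)))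
                                                                        (sym split) (countIncreasing≤decrement+delete 1 pre v post ≤-refl pre-unmarked) ⟩
      countIncreasing 1 (map h′ cliqueLeft) + countIncreasing 1 (map h′ (pre ++ post)) ≤⟨ +-monoʳ-≤ _ (≮⇒≥ many) ⟩
      countIncreasing 1 (map h′ cliqueLeft) + #marked               ≡⟨ +-comm _ #marked ⟩
      #marked + countIncreasing 1 (map h′ cliqueLeft)               ∎))
      where
      open ≤-Reasoning
      #marked = length (filterᵇ markedIndep threatened)
      #unmarked = length (filterᵇ (not ∘ markedIndep) threatened)

  initial-invariant : ∀ f → m < countIncreasing 1 (tabulateₗ f) → Invariant ⊤ (ext k m f)
  initial-invariant f few = record
    { cliqueLeft = allFin k
    ; cliqueLeft-unique = allFin⁺ k
    ; cliqueLeft⇒∈ = λ _ → ∈⊤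
    ; ∈⇒cliqueLeft = λ {a} _ → ∈-allFin a
    ; threatened = allFin m
    ; threatened-complete = λ {b} _ _ → ∈-allFin b
    ; indep-tokens = λ {b} _ → ≤-reflexive (trans (length-tabulate id) (sym (ext-indep f b)))
    ; few-threatened = subst₂ (λ l gs → l < countIncreasing 1 gs) (sym (length-tabulate id))
        (sym (trans (map-tabulate id (ext k m f ∘ clique)) (tabulate-cong (ext-clique f)))) few
    }

  join-paintable : ∀ f → m < countIncreasing 1 (tabulateₗ f) → Paintable (k + m) (JoinAdj k m) (ext k m f)
  join-paintable f few =
    good⇒paintableOn (JoinAdj k m) Invariant invariant⇒tokens (λ inv M _ _ → Move.answer inv M) (initial-invariant f few)

theorem7 : (n : ℕ) (f : Fin (suc n) → ℕ) →
    (∀ i j → i ≤ᶠ j → f i ≤ f j) →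
    (m : ℕ) →
    (Choosable (suc n + m) (JoinAdj (suc n) m) (ext (suc n) m f)
    ⇔ Paintable (suc n + m) (JoinAdj (suc n) m) (ext (suc n) m f))
    × (Paintable (suc n + m) (JoinAdj (suc n) m) (ext (suc n) m f)
    ⇔ m < ψ (xvec f))
theorem7 n f f-mono m =
  mk⇔ (<ψ⇒paintable ∘ choosable⇒<ψ n f f-mono m) (paintable⇒choosable _ _ _) ,
  mk⇔ (choosable⇒<ψ n f f-mono m ∘ paintable⇒choosable _ _ _) <ψ⇒paintable
  where
  <ψ⇒paintable : m < ψ (xvec f) → Paintable (suc n + m) (JoinAdj (suc n) m) (ext (suc n) m f)
  <ψ⇒paintable m<ψ = Painter.join-paintable (suc n) m f (<-≤-trans m<ψ (ψ≤countIncreasing f))
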